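{- Let $n\ge 1$, let $m$ be a complex number (or an indeterminate), and let $(U_e)_{e\ge0}$ be defined by $U_0=0$, $U_1=1$, $U_{e+1}=mU_e+U_{e-1}$. Let $T_n(m)=(a_{i,j})_{1\le i,j\le n}$ with $a_{i,j}=m^{i+j-n-1}\binom{i-1}{n-j}$, and let $w=((-1)^nU_{n-1},(-1)^{n-1}U_{n-2},\ldots,-U_0)^t$, i.e. $w_j=(-1)^{n+1-j}U_{n-j}$. Then: (1) for every integer $e\ge0$, $T_n(m)^{e+1}w=(U_{(n-1)e},U_{(n-1)e+1},\ldots,U_{(n-1)(e+1)})^t$; (2) writing $T_n(m)^e=(a^{(e)}_{i,j})$, for every $e\ge1$ and all $2\le i,j\le n$, \[U_{e-1}a^{(e)}_{i,j}+U_e a^{(e)}_{i,j-1}=U_e a^{(e)}_{i-1,j}+U_{e+1}a^{(e)}_{i-1,j-1};\] (3) $T_n(m)$ is the unique $n\times n$ matrix $(b_{i,j})$ such that $b_{1,j}=0$ for $1\le j<n$, $b_{i,n}=m^{i-1}$ for $1\le i\le n$, and $b_{i,j}=m\,b_{i-1,j}+b_{i-1,j+1}$ for $2\le i\le n$, $1\le j\le n-1$.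
   Context: Binomial coefficients $\binom{a}{b}$ are $0$ when $b<0$ or $b>a$; the entry $m^{i+j-n-1}\binom{i-1}{n-j}$ is $0$ whenever the binomial coefficient vanishes, and otherwise the exponent is nonnegative, so the entries are polynomials in $m$. -}

module Defs where

open import Level using (_⊔_)
open import Algebra.Bundles using (CommutativeRing; Semiring)
open import Data.Nat using (ℕ; zero; suc; _≟_) renaming (_+_ to _+ℕ_; _∸_ to _∸ℕ_)
open import Relation.Nullary using (yes; no)
open import Data.Nat.Combinatorics using (_C_)
open import Data.Fin using (Fin; toℕ; fromℕ; inject₁)
  renaming (zero to fzero; suc to fsuc)
open import Data.Product using (_×_)
import Algebra.Definitions.RawSemiring as RawSemiringDefs

-- Everything is stated over an arbitrary commutative ring R with a
-- distinguished element m (this covers m ∈ ℂ and m an indeterminate,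
-- i.e. R = ℤ[m] or ℂ[m]).
-- Indices are 0-based: the paper's index i (1 ≤ i ≤ n) is  toℕ i + 1.

module _ {c ℓ} (R : CommutativeRing c ℓ) where
  open CommutativeRing R
  open RawSemiringDefs (Semiring.rawSemiring semiring) using (_^_; sum)
    renaming (_×_ to _·ℕ_)

  Matrix : ℕ → Set c
  Matrix n = Fin n → Fin n → Carrier

  Vec : ℕ → Set c
  Vec n = Fin n → Carrier

  U : Carrier → ℕ → Carrier
  U m zero = 0#
  U m (suc zero) = 1#
  U m (suc (suc e)) = m * U m (suc e) + U m e

  _⊗_ : ∀ {n} → Matrix n → Matrix n → Matrix n
  (A ⊗ B) i j = sum (λ k → A i k * B k j)

  idM : ∀ {n} → Matrix n
  idM i j with toℕ i ≟ toℕ j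
  ... | yes _ = 1#
  ... | no _ = 0#

  _^M_ : ∀ {n} → Matrix n → ℕ → Matrix n
  A ^M zero = idM
  A ^M suc e = A ⊗ (A ^M e)

  _⊙_ : ∀ {n} → Matrix n → Vec n → Vec n
  (A ⊙ v) i = sum (λ k → A i k * v k)

  -- With 0-based i', j':  binom(i', n-1-j') · m^(i'+j'+1-n); when the
  -- binomial coefficient is 0 the entry is 0 (the exponent then being
  -- irrelevant), otherwise the exponent is ≥ 0.
  T : (n : ℕ) → Carrier → Matrix n
  T n m i j = (toℕ i C (n ∸ℕ 1 ∸ℕ toℕ j)) ·ℕ (m ^ (toℕ i +ℕ toℕ j +ℕ 1 ∸ℕ n))

  w : (n : ℕ) → Carrier → Vec n
  w n m j = ((- 1#) ^ (n ∸ℕ toℕ j)) * U m (n ∸ℕ 1 ∸ℕ toℕ j)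

  SatisfiesTConditions : (k : ℕ) → Carrier → Matrix (suc k) → Set ℓ
  SatisfiesTConditions k m B =
      (∀ (j : Fin k) → B fzero (inject₁ j) ≈ 0#)
    × (∀ (i : Fin (suc k)) → B i (fromℕ k) ≈ m ^ toℕ i)
    × (∀ (i j : Fin k) →
         B (fsuc i) (inject₁ j) ≈ m * B (inject₁ i) (inject₁ j) + B (inject₁ i) (fsuc j))

-- T acts on windows (v_j, …, v_{j+k}) of solutions of v_{q+2} = m v_{q+1} + v_q.
-- Its entries obey the Pascal rule a_{i+1,j} = m a_{i,j} + a_{i,j+1}, so by induction
-- on i (feeding in the backward extension of v) row i sends the window at 0 to v_{k+i}:
-- T shifts every window by k, T^e by ke. Since U_{-q} = (-1)^{q+1} U_q, the vector w is
-- the window of U at -k, which gives (1). For (2), the relation between rows i and i-1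
-- of T^e with coefficients (U_{e-1}, U_e, U_{e+1}) holds for T^0 = I with (1, 0, 1), and
-- the Pascal rule carries it from T^e to T^{e+1} while advancing the coefficients along
-- the recurrence. In (3) the conditions determine a matrix row by row.
module Submission where

open import Defs
open import Algebra.Bundles using (CommutativeRing; Semiring)
open import Data.Nat using (ℕ; zero; suc; _≤_; _<_; z≤n; s≤s; _≟_)
  renaming (_+_ to _+ℕ_; _*_ to _*ℕ_; _∸_ to _∸ℕ_)
import Data.Nat.Properties as ℕ
open import Data.Nat.GeneralisedArithmetic using (fold)
open import Data.Nat.Combinatorics using (_C_; k>n⇒nCk≡0; nCk+nC[k+1]≡[n+1]C[k+1])
open import Data.Nat.Tactic.RingSolver using (solve-∀)
open import Data.Fin using (Fin; toℕ; fromℕ; inject₁) renaming (zero to fzero; suc to fsuc)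
import Data.Fin.Properties as Fin
open import Data.Fin.Induction using (<-weakInduction)
open import Data.Product using (_×_; _,_)
open import Function using (_∘_)
open import Relation.Nullary using (yes; no; contradiction)
import Relation.Binary.PropositionalEquality as P
open P using (_≡_; _≢_)
import Algebra.Definitions.RawSemiring as RawSemiringDefinitions
import Algebra.Properties.Semiring.Sum as SumProperties
import Algebra.Properties.Semiring.Mult as MultProperties
import Algebra.Properties.Ring as RingProperties

inject₁-or-last : ∀ {p k} {Q : Fin (suc k) → Set p} →
                  Q (fromℕ k) → (∀ j → Q (inject₁ j)) → ∀ j → Q j
inject₁-or-last {k = zero}  last _   fzero    = last
inject₁-or-last {k = suc k} _    inj fzero    = inj fzero
inject₁-or-last {k = suc k} last inj (fsuc j) = inject₁-or-last last (inj ∘ fsuc) j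

k+r+k*e≡r+k*[1+e] : ∀ k r e → k +ℕ r +ℕ k *ℕ e ≡ r +ℕ k *ℕ suc e
k+r+k*e≡r+k*[1+e] = solve-∀

r+k*[1+e]≡k+[k*e+r] : ∀ k r e → r +ℕ k *ℕ suc e ≡ k +ℕ (k *ℕ e +ℕ r)
r+k*[1+e]≡k+[k*e+r] = solve-∀

module _ {ℓ₁ ℓ₂} (R : CommutativeRing ℓ₁ ℓ₂) where
  open CommutativeRing R hiding (zero)
  open RawSemiringDefinitions (Semiring.rawSemiring semiring) using (_^_; sum)
    renaming (_×_ to _·ℕ_)
  open SumProperties semiring
    using (sum-cong-≋; sum-cong-≗; sum-init-last; sum-replicate-zero; ∑-distrib-+; ∑-comm;
           *-distribˡ-sum; *-distribʳ-sum)
  open MultProperties semiring using (×-homo-+; ×-comm-*)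
  open RingProperties ring
    using (-1*x≈-x; -‿distribˡ-*; -‿distribʳ-*; -‿involutive; -0#≈0#; xyx⁻¹≈y)
  open import Algebra.Solver.Ring.NaturalCoefficients.Default commutativeSemiring
    using (solve; _:=_; _:+_; _:*_)
  open import Relation.Binary.Reasoning.Setoid setoid

  -1*[-1*x]≈x : ∀ x → - 1# * (- 1# * x) ≈ x
  -1*[-1*x]≈x x = trans (-1*x≈-x _) (trans (-‿cong (-1*x≈-x x)) (-‿involutive x))

  sumBelow : ℕ → (ℕ → Carrier) → Carrier
  sumBelow a f = sum (λ (j : Fin a) → f (toℕ j))

  sumBelow-cong : ∀ a {f g : ℕ → Carrier} → (∀ j → j < a → f j ≈ g j) →
                  sumBelow a f ≈ sumBelow a g
  sumBelow-cong a f≈g = sum-cong-≋ (λ j → f≈g (toℕ j) (Fin.toℕ<n j))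

  sumBelow-last : ∀ a (f : ℕ → Carrier) → sumBelow (suc a) f ≈ sumBelow a f + f a
  sumBelow-last a f = trans (sum-init-last {a} (f ∘ toℕ))
    (+-cong (reflexive (sum-cong-≗ {a} (P.cong f ∘ Fin.toℕ-inject₁)))
            (reflexive (P.cong f (Fin.toℕ-fromℕ a))))

  sumBelow-zero : ∀ a {f : ℕ → Carrier} → (∀ j → j < a → f j ≈ 0#) → sumBelow a f ≈ 0#
  sumBelow-zero a f≈0 = trans (sumBelow-cong a f≈0) (sum-replicate-zero a)

  sumBelow-linear : ∀ a x {f g h : ℕ → Carrier} → (∀ j → j < a → h j ≈ x * f j + g j) →
                    sumBelow a h ≈ x * sumBelow a f + sumBelow a g
  sumBelow-linear a x {f} {g} {h} h≈ = begin
    sumBelow a h                                   ≈⟨ sumBelow-cong a h≈ ⟩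
    sumBelow a (λ j → x * f j + g j)               ≈⟨ ∑-distrib-+ {a} (λ j → x * f (toℕ j)) (g ∘ toℕ) ⟩
    sumBelow a (λ j → x * f j) + sumBelow a g      ≈⟨ +-congʳ (*-distribˡ-sum {a} x (f ∘ toℕ)) ⟨
    x * sumBelow a f + sumBelow a g                ∎

  sumBelow-assoc : ∀ a b (s : ℕ → Carrier) (G : ℕ → ℕ → Carrier) (v : ℕ → Carrier) →
                   sumBelow b (λ c → sumBelow a (λ j → s j * G j c) * v c)
                   ≈ sumBelow a (λ j → s j * sumBelow b (λ c → G j c * v c))
  sumBelow-assoc a b s G v = begin
    sumBelow b (λ c → sumBelow a (λ j → s j * G j c) * v c)
      ≈⟨ sumBelow-cong b (λ c _ → trans (*-distribʳ-sum {a} (v c) (λ j → s (toℕ j) * G (toℕ j) c))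
                                         (sumBelow-cong a (λ j _ → *-assoc (s j) (G j c) (v c)))) ⟩
    sumBelow b (λ c → sumBelow a (λ j → s j * (G j c * v c)))
      ≈⟨ ∑-comm {b} {a} (λ c j → s (toℕ j) * (G (toℕ j) (toℕ c) * v (toℕ c))) ⟩
    sumBelow a (λ j → sumBelow b (λ c → s j * (G j c * v c)))
      ≈⟨ sumBelow-cong a (λ j _ → *-distribˡ-sum {b} (s j) (λ c → G j (toℕ c) * v (toℕ c))) ⟨
    sumBelow a (λ j → s j * sumBelow b (λ c → G j c * v c)) ∎

  δ : ℕ → ℕ → Carrier
  δ zero    zero    = 1#
  δ zero    (suc _) = 0#
  δ (suc _) zero    = 0#
  δ (suc i) (suc j) = δ i j

  δ-diagonal : ∀ i → δ i i ≡ 1#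
  δ-diagonal zero    = P.refl
  δ-diagonal (suc i) = δ-diagonal i

  δ-off-diagonal : ∀ {i j} → i ≢ j → δ i j ≡ 0#
  δ-off-diagonal {zero}  {zero}  i≢j = contradiction P.refl i≢j
  δ-off-diagonal {zero}  {suc j} _   = P.refl
  δ-off-diagonal {suc i} {zero}  _   = P.refl
  δ-off-diagonal {suc i} {suc j} i≢j = δ-off-diagonal (i≢j ∘ P.cong suc)

  idM≈δ : ∀ {n} (a b : Fin n) → idM R a b ≈ δ (toℕ a) (toℕ b)
  idM≈δ a b with toℕ a ≟ toℕ b
  ... | yes a≡b rewrite a≡b = reflexive (P.sym (δ-diagonal (toℕ b)))
  ... | no  a≢b = reflexive (P.sym (δ-off-diagonal a≢b))

  sumBelow-δ : ∀ a i (f : ℕ → Carrier) → i < a → sumBelow a (λ j → δ i j * f j) ≈ f i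
  sumBelow-δ (suc a) zero f _ = begin
    1# * f 0 + sumBelow a (λ j → 0# * f (suc j))
      ≈⟨ +-cong (*-identityˡ _) (sumBelow-zero a (λ j _ → zeroˡ (f (suc j)))) ⟩
    f 0 + 0#
      ≈⟨ +-identityʳ _ ⟩
    f 0 ∎
  sumBelow-δ (suc a) (suc i) f (s≤s i<a) =
    trans (+-cong (zeroˡ _) (sumBelow-δ a i (f ∘ suc) i<a)) (+-identityˡ _)

  -- Both sides of the identity in (2) have this shape, with P a row of T^e.
  comb : Carrier → Carrier → (ℕ → Carrier) → ℕ → Carrier
  comb α β P zero    = α * P zero
  comb α β P (suc c) = α * P (suc c) + β * P c

  comb-sumBelow : ∀ a α β (s : ℕ → Carrier) (G : ℕ → ℕ → Carrier) c →
                  comb α β (λ c′ → sumBelow a (λ j → s j * G j c′)) c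
                  ≈ sumBelow a (λ j → s j * comb α β (G j) c)
  comb-sumBelow a α β s G zero =
    trans (*-distribˡ-sum {a} α (λ j → s (toℕ j) * G (toℕ j) 0))
          (sumBelow-cong a (λ j _ → x*[y*z]≈y*[x*z] α (s j) (G j 0)))
    where
    x*[y*z]≈y*[x*z] : ∀ x y z → x * (y * z) ≈ y * (x * z)
    x*[y*z]≈y*[x*z] = solve 3 (λ x y z → (x :* (y :* z)) := (y :* (x :* z))) refl
  comb-sumBelow a α β s G (suc c) = begin
    α * sumBelow a (λ j → s j * G j (suc c)) + β * sumBelow a (λ j → s j * G j c)
      ≈⟨ +-cong (*-distribˡ-sum {a} α (λ j → s (toℕ j) * G (toℕ j) (suc c)))
                (*-distribˡ-sum {a} β (λ j → s (toℕ j) * G (toℕ j) c)) ⟩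
    sumBelow a (λ j → α * (s j * G j (suc c))) + sumBelow a (λ j → β * (s j * G j c))
      ≈⟨ ∑-distrib-+ {a} (λ j → α * (s (toℕ j) * G (toℕ j) (suc c)))
                         (λ j → β * (s (toℕ j) * G (toℕ j) c)) ⟨
    sumBelow a (λ j → α * (s j * G j (suc c)) + β * (s j * G j c))
      ≈⟨ sumBelow-cong a (λ j _ → factor α β (s j) (G j (suc c)) (G j c)) ⟩
    sumBelow a (λ j → s j * comb α β (G j) (suc c)) ∎
    where
    factor : ∀ α β x y z → α * (x * y) + β * (x * z) ≈ x * (α * y + β * z)
    factor = solve 5 (λ α β x y z → (α :* (x :* y) :+ β :* (x :* z))
                                    := (x :* (α :* y :+ β :* z))) refl

  comb-recurrence : ∀ x {α β γ γ′} → γ ≈ x * β + α → γ′ ≈ x * γ + β → ∀ P c →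
                    comb γ γ′ P c ≈ x * comb β γ P c + comb α β P c
  comb-recurrence x {α} {β} {γ} hγ hγ′ P zero =
    trans (*-congʳ hγ)
          (solve 4 (λ x α β p → ((x :* β :+ α) :* p) := (x :* (β :* p) :+ α :* p)) refl x α β (P 0))
  comb-recurrence x {α} {β} {γ} hγ hγ′ P (suc c) =
    trans (+-cong (*-congʳ hγ) (*-congʳ hγ′))
      (solve 6 (λ x α β γ p₁ p₀ →
                  ((x :* β :+ α) :* p₁ :+ (x :* γ :+ β) :* p₀)
                  := (x :* (β :* p₁ :+ γ :* p₀) :+ (α :* p₁ :+ β :* p₀)))
             refl x α β γ (P (suc c)) (P c))

  module _ (m : Carrier) where

    Recurrent : (ℕ → Carrier) → Set ℓ₂
    Recurrent v = ∀ q → v (suc (suc q)) ≈ m * v (suc q) + v q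

    -- The unique recurrent sequence whose tail is v.
    stepBack : (ℕ → Carrier) → ℕ → Carrier
    stepBack v zero    = v 1 - m * v 0
    stepBack v (suc q) = v q

    stepBack-next : ∀ v → Recurrent v → ∀ q → m * v q + stepBack v q ≈ v (suc q)
    stepBack-next v _   zero    = trans (sym (+-assoc _ _ _)) (xyx⁻¹≈y (m * v 0) (v 1))
    stepBack-next v rec (suc q) = sym (rec q)

    stepBack-recurrent : ∀ v → Recurrent v → Recurrent (stepBack v)
    stepBack-recurrent v rec q = sym (stepBack-next v rec q)

    fold-stepBack-recurrent : ∀ a v → Recurrent v → Recurrent (fold v stepBack a)
    fold-stepBack-recurrent zero    v rec = rec
    fold-stepBack-recurrent (suc a) v rec =
      stepBack-recurrent (fold v stepBack a) (fold-stepBack-recurrent a v rec)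

    fold-stepBack-+ : ∀ a v q → fold v stepBack a (a +ℕ q) ≡ v q
    fold-stepBack-+ zero    v q = P.refl
    fold-stepBack-+ (suc a) v q = fold-stepBack-+ a v q

    -- U_{-q} = (-1)^{q+1} U_q extends U to negative indices; this is the recurrence read backwards.
    U-negative-recurrence : ∀ q →
      (- 1#) ^ suc q * U R m q - m * ((- 1#) ^ suc (suc q) * U R m (suc q))
      ≈ (- 1#) ^ suc (suc (suc q)) * U R m (suc (suc q))
    U-negative-recurrence q = begin
      s * u₀ - m * (- 1# * s * u₁)   ≈⟨ +-congˡ (-‿cong (*-congˡ (*-congʳ (-1*x≈-x s)))) ⟩
      s * u₀ - m * (- s * u₁)        ≈⟨ +-congˡ (-‿cong (*-congˡ (sym (-‿distribˡ-* s u₁)))) ⟩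
      s * u₀ - m * - (s * u₁)        ≈⟨ +-congˡ (-‿cong (sym (-‿distribʳ-* m (s * u₁)))) ⟩
      s * u₀ - - (m * (s * u₁))      ≈⟨ +-congˡ (-‿involutive _) ⟩
      s * u₀ + m * (s * u₁)          ≈⟨ solve 4 (λ s u₀ m u₁ → (s :* u₀ :+ m :* (s :* u₁))
                                                           := (s :* (m :* u₁ :+ u₀))) refl s u₀ m u₁ ⟩
      s * (m * u₁ + u₀)              ≈⟨ *-congʳ (-1*[-1*x]≈x s) ⟨
      - 1# * (- 1# * s) * (m * u₁ + u₀) ∎
      where
      s = (- 1#) ^ suc q
      u₀ = U R m q
      u₁ = U R m (suc q)

    fold-stepBack-U : ∀ a j → j ≤ a →
                      fold (U R m) stepBack a j ≈ (- 1#) ^ suc (a ∸ℕ j) * U R m (a ∸ℕ j)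
    fold-stepBack-U zero          zero    _         = sym (zeroʳ _)
    fold-stepBack-U (suc a)       (suc j) (s≤s j≤a) = fold-stepBack-U a j j≤a
    fold-stepBack-U (suc zero)    zero    _         = begin
      1# - m * 0#            ≈⟨ +-congˡ (trans (-‿cong (zeroʳ m)) -0#≈0#) ⟩
      1# + 0#                ≈⟨ +-identityʳ 1# ⟩
      1#                     ≈⟨ trans (*-identityʳ _) (-1*[-1*x]≈x 1#) ⟨
      - 1# * (- 1# * 1#) * 1# ∎
    fold-stepBack-U (suc (suc a)) zero    _         =
      trans (+-cong (fold-stepBack-U a 0 z≤n) (-‿cong (*-congˡ (fold-stepBack-U (suc a) 0 z≤n))))
            (U-negative-recurrence a)

    module _ (k : ℕ) where

      Tₖ : Matrix R (suc k)
      Tₖ = T R (suc k) m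

      conditions-unique : ∀ {B B′ : Matrix R (suc k)} →
                          SatisfiesTConditions R k m B → SatisfiesTConditions R k m B′ →
                          ∀ i j → B i j ≈ B′ i j
      conditions-unique {B} {B′} (top , right , pascal) (top′ , right′ , pascal′) =
        <-weakInduction (λ i → ∀ j → B i j ≈ B′ i j)
          (row-from-inner (λ j → trans (top j) (sym (top′ j))))
          (λ i above → row-from-inner (λ j →
            trans (pascal i j)
                  (trans (+-cong (*-congˡ (above (inject₁ j))) (above (fsuc j))) (sym (pascal′ i j)))))
        where
        row-from-inner : ∀ {i} → (∀ j → B i (inject₁ j) ≈ B′ i (inject₁ j)) → ∀ j → B i j ≈ B′ i j
        row-from-inner {i} = inject₁-or-last (trans (right i) (sym (right′ i)))

      entry : ℕ → ℕ → Carrier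
      entry i j = (i C (k ∸ℕ j)) ·ℕ (m ^ (i +ℕ j ∸ℕ k))

      T≡entry : ∀ a b → Tₖ a b ≡ entry (toℕ a) (toℕ b)
      T≡entry a b = P.cong (λ e → (toℕ a C (k ∸ℕ toℕ b)) ·ℕ (m ^ (e ∸ℕ suc k)))
                           (ℕ.+-comm (toℕ a +ℕ toℕ b) 1)

      entry-first-row : ∀ j → j < k → entry 0 j ≈ 0#
      entry-first-row j j<k =
        reflexive (P.cong (_·ℕ (m ^ (j ∸ℕ k))) (k>n⇒nCk≡0 (ℕ.m<n⇒0<n∸m j<k)))

      entry-first-column : ∀ i → i < k → entry i 0 ≈ 0#
      entry-first-column i i<k = reflexive (P.cong (_·ℕ (m ^ (i +ℕ 0 ∸ℕ k))) (k>n⇒nCk≡0 i<k))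

      entry-last-column : ∀ i → entry i k ≈ m ^ i
      entry-last-column i =
        trans (reflexive (P.cong₂ (λ a e → (i C a) ·ℕ (m ^ e)) (ℕ.n∸n≡0 k) (ℕ.m+n∸n≡m i k)))
              (+-identityʳ _)

      -- Where the binomial coefficient is nonzero, the truncated exponent is the true one.
      binomial-weight-suc : ∀ i p s → (p ≤ i → k ≤ s) →
                            (i C p) ·ℕ (m ^ (suc s ∸ℕ k)) ≈ m * ((i C p) ·ℕ (m ^ (s ∸ℕ k)))
      binomial-weight-suc i p s honest with p ℕ.≤? i
      ... | yes p≤i =
        trans (reflexive (P.cong (λ e → (i C p) ·ℕ (m ^ e)) (ℕ.+-∸-assoc 1 (honest p≤i))))
              (sym (×-comm-* (i C p) m _))
      ... | no  p≰i rewrite k>n⇒nCk≡0 (ℕ.≰⇒> p≰i) = sym (zeroʳ m)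

      entry-pascal : ∀ i j → j < k → entry (suc i) j ≈ m * entry i j + entry i (suc j)
      entry-pascal i j j<k = begin
        entry (suc i) j
          ≡⟨ P.cong (λ a → (suc i C a) ·ℕ (m ^ E′)) k∸j≡1+q ⟩
        (suc i C suc q) ·ℕ (m ^ E′)
          ≡⟨ P.cong (_·ℕ (m ^ E′)) (nCk+nC[k+1]≡[n+1]C[k+1] i q) ⟨
        (i C q +ℕ i C suc q) ·ℕ (m ^ E′)
          ≈⟨ trans (×-homo-+ _ (i C q) (i C suc q)) (+-comm _ _) ⟩
        (i C suc q) ·ℕ (m ^ E′) + (i C q) ·ℕ (m ^ E′)
          ≈⟨ +-congʳ (binomial-weight-suc i (suc q) (i +ℕ j) honest) ⟩
        m * ((i C suc q) ·ℕ (m ^ (i +ℕ j ∸ℕ k))) + (i C q) ·ℕ (m ^ E′)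
          ≡⟨ P.cong₂ (λ a e → m * ((i C a) ·ℕ (m ^ (i +ℕ j ∸ℕ k))) + (i C q) ·ℕ (m ^ (e ∸ℕ k)))
                     (P.sym k∸j≡1+q) (P.sym (ℕ.+-suc i j)) ⟩
        m * entry i j + entry i (suc j) ∎
        where
        q = k ∸ℕ suc j
        E′ = suc (i +ℕ j) ∸ℕ k
        k∸j≡1+q : k ∸ℕ j ≡ suc q
        k∸j≡1+q = ℕ.+-∸-assoc 1 j<k
        honest : suc q ≤ i → k ≤ i +ℕ j
        honest 1+q≤i = P.subst (_≤ i +ℕ j)
          (P.trans (P.cong (_+ℕ j) (P.sym k∸j≡1+q)) (ℕ.m∸n+n≡m (ℕ.<⇒≤ j<k)))
          (ℕ.+-monoˡ-≤ j 1+q≤i)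

      rowDot : ℕ → (ℕ → Carrier) → Carrier
      rowDot i v = sumBelow (suc k) (λ j → entry i j * v j)

      -- Only v′ (j + 1) for j < k matters, since the column j = 0 vanishes above the last row.
      rowDot-pascal : ∀ {i} {v v′ : ℕ → Carrier} → i < k → (∀ j → j < k → v′ (suc j) ≈ v j) →
                      rowDot (suc i) v ≈ m * rowDot i v + rowDot i v′
      rowDot-pascal {i} {v} {v′} i<k v′≈v = begin
        rowDot (suc i) v
          ≈⟨ sumBelow-last k (λ j → entry (suc i) j * v j) ⟩
        sumBelow k (λ j → entry (suc i) j * v j) + entry (suc i) k * v k
          ≈⟨ +-cong (sumBelow-linear k m termwise) last ⟩
        m * sumBelow k (λ j → entry i j * v j) + shifted + m * (entry i k * v k)
          ≈⟨ solve 4 (λ m a b c → (m :* a :+ b :+ m :* c) := (m :* (a :+ c) :+ b)) refl m _ shifted _ ⟩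
        m * (sumBelow k (λ j → entry i j * v j) + entry i k * v k) + shifted
          ≈⟨ +-cong (*-congˡ (sumBelow-last k (λ j → entry i j * v j))) first-column-vanishes ⟨
        m * rowDot i v + rowDot i v′ ∎
        where
        shifted = sumBelow k (λ j → entry i (suc j) * v′ (suc j))
        termwise : ∀ j → j < k →
                   entry (suc i) j * v j ≈ m * (entry i j * v j) + entry i (suc j) * v′ (suc j)
        termwise j j<k = begin
          entry (suc i) j * v j
            ≈⟨ *-congʳ (entry-pascal i j j<k) ⟩
          (m * entry i j + entry i (suc j)) * v j
            ≈⟨ solve 4 (λ m a b x → ((m :* a :+ b) :* x) := (m :* (a :* x) :+ b :* x)) refl m _ _ _ ⟩
          m * (entry i j * v j) + entry i (suc j) * v j
            ≈⟨ +-congˡ (*-congˡ (sym (v′≈v j j<k))) ⟩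
          m * (entry i j * v j) + entry i (suc j) * v′ (suc j) ∎
        last : entry (suc i) k * v k ≈ m * (entry i k * v k)
        last = trans (*-congʳ (trans (entry-last-column (suc i)) (*-congˡ (sym (entry-last-column i)))))
                     (*-assoc _ _ _)
        first-column-vanishes : rowDot i v′ ≈ shifted
        first-column-vanishes =
          trans (+-congʳ (trans (*-congʳ (entry-first-column i i<k)) (zeroˡ _))) (+-identityˡ _)

      rowDot-window : ∀ {v} → Recurrent v → ∀ i → i ≤ k → rowDot i v ≈ v (k +ℕ i)
      rowDot-window {v} _ zero _ = begin
        rowDot 0 v
          ≈⟨ sumBelow-last k (λ j → entry 0 j * v j) ⟩
        sumBelow k (λ j → entry 0 j * v j) + entry 0 k * v k
          ≈⟨ +-cong (sumBelow-zero k (λ j j<k → trans (*-congʳ (entry-first-row j j<k)) (zeroˡ (v j))))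
                    (trans (*-congʳ (entry-last-column 0)) (*-identityˡ (v k))) ⟩
        0# + v k
          ≈⟨ +-identityˡ (v k) ⟩
        v k
          ≡⟨ P.cong v (ℕ.+-identityʳ k) ⟨
        v (k +ℕ 0) ∎
      rowDot-window {v} rec (suc i) i<k = begin
        rowDot (suc i) v
          ≈⟨ rowDot-pascal {v′ = stepBack v} i<k (λ _ _ → refl) ⟩
        m * rowDot i v + rowDot i (stepBack v)
          ≈⟨ +-cong (*-congˡ (rowDot-window rec i i≤k))
                    (rowDot-window (stepBack-recurrent v rec) i i≤k) ⟩
        m * v (k +ℕ i) + stepBack v (k +ℕ i)
          ≈⟨ stepBack-next v rec (k +ℕ i) ⟩
        v (suc (k +ℕ i))
          ≡⟨ P.cong v (ℕ.+-suc k i) ⟨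
        v (k +ℕ suc i) ∎
        where
        i≤k = ℕ.<⇒≤ i<k

      power : ℕ → ℕ → ℕ → Carrier
      power zero        = δ
      power (suc e) i c = rowDot i (λ j → power e j c)

      ^M≈power : ∀ e a b → (_^M_ R Tₖ e) a b ≈ power e (toℕ a) (toℕ b)
      ^M≈power zero    a b = idM≈δ a b
      ^M≈power (suc e) a b = sum-cong-≋ (λ j → *-cong (reflexive (T≡entry a j)) (^M≈power e j b))

      power-window : ∀ {v} → Recurrent v → ∀ e r → r ≤ k →
                     sumBelow (suc k) (λ c → power e r c * v c) ≈ v (r +ℕ k *ℕ e)
      power-window {v} rec zero r r≤k =
        trans (sumBelow-δ (suc k) r v (s≤s r≤k))
              (reflexive (P.cong v (P.sym (P.trans (P.cong (r +ℕ_) (ℕ.*-zeroʳ k)) (ℕ.+-identityʳ r)))))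
      power-window {v} rec (suc e) r r≤k = begin
        sumBelow (suc k) (λ c → rowDot r (λ j → power e j c) * v c)
          ≈⟨ sumBelow-assoc (suc k) (suc k) (entry r) (power e) v ⟩
        rowDot r (λ j → sumBelow (suc k) (λ c → power e j c * v c))
          ≈⟨ sumBelow-cong (suc k) (λ j j<1+k →
               *-congˡ {entry r j} (power-window rec e j (ℕ.≤-pred j<1+k))) ⟩
        rowDot r (λ j → v (j +ℕ k *ℕ e))
          ≈⟨ rowDot-window (rec ∘ (_+ℕ k *ℕ e)) r r≤k ⟩
        v (k +ℕ r +ℕ k *ℕ e)
          ≡⟨ P.cong v (k+r+k*e≡r+k*[1+e] k r e) ⟩
        v (r +ℕ k *ℕ suc e) ∎

      -- w is the window of U at positions -k, …, 0.
      w≈U-window : ∀ j → w R (suc k) m j ≈ fold (U R m) stepBack k (toℕ j)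
      w≈U-window j = sym (trans (fold-stepBack-U k (toℕ j) j≤k)
        (reflexive (P.cong (λ a → (- 1#) ^ a * U R m (k ∸ℕ toℕ j)) (P.sym (ℕ.+-∸-assoc 1 j≤k)))))
        where
        j≤k = Fin.toℕ≤pred[n]′ j

      T^-window : ∀ e (r : Fin (suc k)) →
                  _⊙_ R (_^M_ R Tₖ (suc e)) (w R (suc k) m) r ≈ U R m (k *ℕ e +ℕ toℕ r)
      T^-window e r = begin
        _⊙_ R (_^M_ R Tₖ (suc e)) (w R (suc k) m) r
          ≈⟨ sum-cong-≋ (λ j → *-cong (^M≈power (suc e) r j) (w≈U-window j)) ⟩
        sumBelow (suc k) (λ c → power (suc e) (toℕ r) c * W c)
          ≈⟨ power-window (fold-stepBack-recurrent k (U R m) (λ _ → refl))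
                          (suc e) (toℕ r) (Fin.toℕ≤pred[n]′ r) ⟩
        W (toℕ r +ℕ k *ℕ suc e)
          ≡⟨ P.cong W (r+k*[1+e]≡k+[k*e+r] k (toℕ r) e) ⟩
        W (k +ℕ (k *ℕ e +ℕ toℕ r))
          ≡⟨ fold-stepBack-+ k (U R m) (k *ℕ e +ℕ toℕ r) ⟩
        U R m (k *ℕ e +ℕ toℕ r) ∎
        where
        W = fold (U R m) stepBack k

      AdjacentRows : Carrier → Carrier → Carrier → (ℕ → ℕ → Carrier) → Set ℓ₂
      AdjacentRows α β γ G = ∀ i → i < k → ∀ c → comb α β (G (suc i)) c ≈ comb β γ (G i) c

      δ-adjacentRows : AdjacentRows 1# 0# 1# δ
      δ-adjacentRows i _ zero    = trans (zeroʳ 1#) (sym (zeroˡ (δ i 0)))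
      δ-adjacentRows i _ (suc c) = begin
        1# * δ i c + 0# * δ (suc i) c ≈⟨ trans (+-cong (*-identityˡ _) (zeroˡ _)) (+-identityʳ _) ⟩
        δ i c                         ≈⟨ trans (+-cong (zeroˡ _) (*-identityˡ _)) (+-identityˡ _) ⟨
        0# * δ i (suc c) + 1# * δ i c ∎

      adjacentRows-step : ∀ {α β γ γ′ G} → γ ≈ m * β + α → γ′ ≈ m * γ + β →
                          AdjacentRows α β γ G → AdjacentRows β γ γ′ (λ i c → rowDot i (λ j → G j c))
      adjacentRows-step {α} {β} {γ} {γ′} {G} hγ hγ′ adjacent i i<k c = begin
        comb β γ (λ c′ → rowDot (suc i) (λ j → G j c′)) c
          ≈⟨ comb-sumBelow (suc k) β γ (entry (suc i)) G c ⟩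
        rowDot (suc i) (λ j → comb β γ (G j) c)
          ≈⟨ rowDot-pascal {v′ = λ j → comb α β (G j) c} i<k (λ j j<k → adjacent j j<k c) ⟩
        m * rowDot i (λ j → comb β γ (G j) c) + rowDot i (λ j → comb α β (G j) c)
          ≈⟨ sumBelow-linear (suc k) m (λ j _ → trans (*-congˡ (comb-recurrence m hγ hγ′ (G j) c))
                                                      (distribute (entry i j) _ _)) ⟨
        rowDot i (λ j → comb γ γ′ (G j) c)
          ≈⟨ comb-sumBelow (suc k) γ γ′ (entry i) G c ⟨
        comb γ γ′ (λ c′ → rowDot i (λ j → G j c′)) c ∎
        where
        distribute : ∀ e x y → e * (m * x + y) ≈ m * (e * x) + e * y
        distribute = solve 4 (λ m e x y → (e :* (m :* x :+ y)) := (m :* (e :* x) :+ e :* y)) refl m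

      power-adjacentRows : ∀ e →
        AdjacentRows (U R m e) (U R m (suc e)) (U R m (suc (suc e))) (power (suc e))
      power-adjacentRows zero    =
        adjacentRows-step (sym (trans (+-congʳ (zeroʳ m)) (+-identityˡ 1#))) refl δ-adjacentRows
      power-adjacentRows (suc e) = adjacentRows-step refl refl (power-adjacentRows e)

      T^-adjacent : ∀ (e : ℕ) → 1 ≤ e → (i j : Fin k) →
          let A = _^M_ R Tₖ e
          in U R m (e ∸ℕ 1) * A (fsuc i) (fsuc j) + U R m e * A (fsuc i) (inject₁ j)
             ≈ U R m e * A (inject₁ i) (fsuc j) + U R m (suc e) * A (inject₁ i) (inject₁ j)
      T^-adjacent (suc e) _ i j = begin
        U R m e * A (fsuc i) (fsuc j) + U R m (suc e) * A (fsuc i) (inject₁ j)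
          ≈⟨ +-cong (*-congˡ (A≈ P.refl P.refl)) (*-congˡ (A≈ P.refl (Fin.toℕ-inject₁ j))) ⟩
        comb (U R m e) (U R m (suc e)) (power (suc e) (suc (toℕ i))) (suc (toℕ j))
          ≈⟨ power-adjacentRows e (toℕ i) (Fin.toℕ<n i) (suc (toℕ j)) ⟩
        comb (U R m (suc e)) (U R m (suc (suc e))) (power (suc e) (toℕ i)) (suc (toℕ j))
          ≈⟨ +-cong (*-congˡ (A≈ (Fin.toℕ-inject₁ i) P.refl))
                    (*-congˡ (A≈ (Fin.toℕ-inject₁ i) (Fin.toℕ-inject₁ j))) ⟨
        U R m (suc e) * A (inject₁ i) (fsuc j) + U R m (suc (suc e)) * A (inject₁ i) (inject₁ j) ∎
        where
        A = _^M_ R Tₖ (suc e)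
        A≈ : ∀ {a b i c} → toℕ a ≡ i → toℕ b ≡ c → A a b ≈ power (suc e) i c
        A≈ {a} {b} P.refl P.refl = ^M≈power (suc e) a b

      T-satisfies : SatisfiesTConditions R k m Tₖ
      T-satisfies =
          (λ j → trans (T≈ fzero (inject₁ j) P.refl P.refl) (entry-first-row _ (Fin.inject₁ℕ< j)))
        , (λ i → trans (T≈ i (fromℕ k) P.refl (Fin.toℕ-fromℕ k)) (entry-last-column (toℕ i)))
        , (λ i j → trans (T≈ (fsuc i) (inject₁ j) P.refl (Fin.toℕ-inject₁ j))
                     (trans (entry-pascal (toℕ i) (toℕ j) (Fin.toℕ<n j))
                       (sym (+-cong (*-congˡ (T≈ (inject₁ i) (inject₁ j) (Fin.toℕ-inject₁ i)
                                                                              (Fin.toℕ-inject₁ j)))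
                                    (T≈ (inject₁ i) (fsuc j) (Fin.toℕ-inject₁ i) P.refl)))))
        where
        T≈ : ∀ a b {i j} → toℕ a ≡ i → toℕ b ≡ j → Tₖ a b ≈ entry i j
        T≈ a b P.refl P.refl = reflexive (T≡entry a b)

theorem3p2 : ∀ {c ℓ} (R : CommutativeRing c ℓ) (m : CommutativeRing.Carrier R) (k : ℕ) →
    let open CommutativeRing R
        n = suc k
        Tn = T R n m
    in (∀ (e : ℕ) (r : Fin n) →
          _⊙_ R (_^M_ R Tn (suc e)) (w R n m) r ≈ U R m (k *ℕ e +ℕ toℕ r))
     × (∀ (e : ℕ) → 1 ≤ e → (i j : Fin k) →
          let A = _^M_ R Tn e
          in U R m (e ∸ℕ 1) * A (fsuc i) (fsuc j) + U R m e * A (fsuc i) (inject₁ j)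
             ≈ U R m e * A (inject₁ i) (fsuc j) + U R m (suc e) * A (inject₁ i) (inject₁ j))
     × (SatisfiesTConditions R k m Tn
        × (∀ (B : Matrix R n) → SatisfiesTConditions R k m B → ∀ (i j : Fin n) → B i j ≈ Tn i j))
theorem3p2 R m k =
    T^-window R m k
  , T^-adjacent R m k
  , T-satisfies R m k
  , λ _ satisfies → conditions-unique R m k satisfies (T-satisfies R m k)
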